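{- The universe $\mathcal{M}$ of all games is weak.
   Context: $\mathcal{M}$ is the set of all short partizan game forms, played under the misère convention (a player unable to move wins). $o_L(G)\in\{\mathscr{L},\mathscr{R}\}$ is the winner when Left moves first. Augmented forms (Siegel): game forms in which each subposition may carry a Left and/or Right tombstone (markers, not options); an augmented form is Left end-like if it has no Left options or carries a Left tombstone (Right end-like symmetrically); a player to move on a position end-like for them wins immediately; $G+H$ carries a Left tombstone iff both summands are Left end-like and at least one carries one (symmetrically for Right). For a set of games $\mathcal{A}$, an augmented form $G$ is Left $\mathcal{A}$-strong if $o_L(G+X)=\mathscr{L}$ for all Left ends (games with no Left options) $X\in\mathcal{A}$, and Right $\mathcal{A}$-strong symmetrically. $\mathcal{A}$ is Left weak if an augmented form is Left $\mathcal{A}$-strong iff it is Left end-like, Right weak symmetrically, and weak if both. -}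

module Defs where

open import Data.Nat using (ℕ; zero; suc; _+_)
open import Data.Fin using (Fin; splitAt)
open import Data.Bool using (Bool; true; false; _∧_; _∨_; if_then_else_)
open import Data.Sum using (_⊎_; [_,_]′)
open import Data.Unit using (⊤)
open import Data.Product using (_×_)
open import Relation.Binary.PropositionalEquality using (_≡_)
open import Function.Bundles using (_⇔_)

data Game : Set where
  mkG : (nL nR : ℕ) → (Fin nL → Game) → (Fin nR → Game) → Game

-- Augmented forms (Siegel): game forms whose subpositions may carry a
-- Left tombstone (tL) and/or a Right tombstone (tR); these are markers.
data AForm : Set where
  mkA : (tL tR : Bool) (nL nR : ℕ) → (Fin nL → AForm) → (Fin nR → AForm) → AForm

ι : Game → AForm
ι (mkG nL nR gL gR) = mkA false false nL nR (λ i → ι (gL i)) (λ j → ι (gR j))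

IsLeftEnd : Game → Set
IsLeftEnd (mkG nL _ _ _) = nL ≡ 0

IsRightEnd : Game → Set
IsRightEnd (mkG _ nR _ _) = nR ≡ 0

isZero : ℕ → Bool
isZero zero = true
isZero (suc _) = false

leftEndLike? : AForm → Bool
leftEndLike? (mkA tL _ nL _ _ _) = tL ∨ isZero nL

rightEndLike? : AForm → Bool
rightEndLike? (mkA _ tR _ nR _ _) = tR ∨ isZero nR

LeftEndLike : AForm → Set
LeftEndLike G = leftEndLike? G ≡ true

RightEndLike : AForm → Set
RightEndLike G = rightEndLike? G ≡ true

tombL : AForm → Bool
tombL (mkA tL _ _ _ _ _) = tL

tombR : AForm → Bool
tombR (mkA _ tR _ _ _ _) = tR

_⊕_ : AForm → AForm → AForm
G@(mkA tL tR nL nR gL gR) ⊕ H@(mkA sL sR mL mR hL hR) =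
  mkA ((leftEndLike? G ∧ leftEndLike? H) ∧ (tL ∨ sL))
      ((rightEndLike? G ∧ rightEndLike? H) ∧ (tR ∨ sR))
      (nL + mL) (nR + mR)
      (λ k → [ (λ i → gL i ⊕ H) , (λ j → G ⊕ hL j) ]′ (splitAt nL k))
      (λ k → [ (λ i → gR i ⊕ H) , (λ j → G ⊕ hR j) ]′ (splitAt nR k))

anyFin : (n : ℕ) → (Fin n → Bool) → Bool
anyFin zero f = false
anyFin (suc n) f = f Fin.zero ∨ anyFin n (λ i → f (Fin.suc i))

allFin : (n : ℕ) → (Fin n → Bool) → Bool
allFin zero f = true
allFin (suc n) f = f Fin.zero ∧ allFin n (λ i → f (Fin.suc i))

-- Misère play on augmented forms: a player to move on a position end-like
-- for them wins immediately.
-- leftWinsL G : Left wins G moving first;  leftWinsR G : Left wins G when Right moves first.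
leftWinsL : AForm → Bool
leftWinsR : AForm → Bool
leftWinsL G@(mkA _ _ nL _ gL _) = leftEndLike? G ∨ anyFin nL (λ i → leftWinsR (gL i))
leftWinsR G@(mkA _ _ _ nR _ gR) =
  if rightEndLike? G then false else allFin nR (λ j → leftWinsL (gR j))

data Outcome : Set where
  𝓛 𝓡 : Outcome

oL : AForm → Outcome
oL G = if leftWinsL G then 𝓛 else 𝓡

oR : AForm → Outcome
oR G = if leftWinsR G then 𝓛 else 𝓡

GameSet : Set₁
GameSet = Game → Set

𝓜 : GameSet
𝓜 _ = ⊤

LeftStrong : GameSet → AForm → Set
LeftStrong 𝒜 G = (X : Game) → 𝒜 X → IsLeftEnd X → oL (G ⊕ ι X) ≡ 𝓛

RightStrong : GameSet → AForm → Set
RightStrong 𝒜 G = (X : Game) → 𝒜 X → IsRightEnd X → oR (G ⊕ ι X) ≡ 𝓡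

LeftWeak : GameSet → Set
LeftWeak 𝒜 = (G : AForm) → LeftStrong 𝒜 G ⇔ LeftEndLike G

RightWeak : GameSet → Set
RightWeak 𝒜 = (G : AForm) → RightStrong 𝒜 G ⇔ RightEndLike G

Weak : GameSet → Set
Weak 𝒜 = LeftWeak 𝒜 × RightWeak 𝒜

{-# OPTIONS --safe #-}
-- Adding a Left end X to a Left end-like G leaves it Left end-like, so Left moving first
-- wins G + X at once. Conversely, the spoiler S(H) = { S(H^R₀) (or 0 if H has no Right
-- option) | S(H^L) } makes Left, moving first, lose H + S(H): Right answers H^L + S(H) by
-- H^L + S(H^L), and H + S(H^R₀) by H^R₀ + S(H^R₀) (when H has no Right option, H + 0 is a
-- Right end-like win for Right). So if G is not Left end-like, Left loses G + X moving first
-- for the Left end X = { | S(G^L) }: Left must move to some G^L + X, answered by G^L + S(G^L).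
-- The Right half is the mirror image.

module Submission where

open import Defs
open import Data.Nat using (ℕ; zero; suc; _+_)
open import Data.Fin using (Fin; zero; suc; splitAt; _↑ʳ_; _↑ˡ_)
open import Data.Fin.Properties using (splitAt-↑ʳ; splitAt-↑ˡ)
open import Data.Bool using (Bool; true; false; _∧_; _∨_; if_then_else_)
open import Data.Bool.Properties using (∨-zeroʳ; ∧-zeroʳ; ∧-identityʳ)
open import Data.Sum using (inj₁; inj₂; [_,_]′)
open import Data.Product using (_,_)
open import Data.Unit using (tt)
open import Data.Empty using (⊥-elim)
open import Relation.Nullary using (¬_)
open import Relation.Binary.PropositionalEquality
open import Function.Bundles using (mk⇔)

nLeft nRight : AForm → ℕ
nLeft (mkA _ _ nL _ _ _) = nL
nRight (mkA _ _ _ nR _ _) = nR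

leftOpt : (G : AForm) → Fin (nLeft G) → AForm
leftOpt (mkA _ _ _ _ gL _) = gL

rightOpt : (G : AForm) → Fin (nRight G) → AForm
rightOpt (mkA _ _ _ _ _ gR) = gR

zeroG : Game
zeroG = mkG 0 0 (λ ()) (λ ())

𝓡≢𝓛 : ¬ 𝓡 ≡ 𝓛
𝓡≢𝓛 ()

anyFin-false : ∀ n (f : Fin n → Bool) → (∀ i → f i ≡ false) → anyFin n f ≡ false
anyFin-false zero    f all = refl
anyFin-false (suc n) f all rewrite all zero = anyFin-false n (λ i → f (suc i)) (λ i → all (suc i))

anyFin-true : ∀ n (f : Fin n → Bool) i → f i ≡ true → anyFin n f ≡ true
anyFin-true (suc n) f zero    fi rewrite fi = refl
anyFin-true (suc n) f (suc i) fi rewrite anyFin-true n (λ k → f (suc k)) i fi = ∨-zeroʳ (f zero)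

allFin-true : ∀ n (f : Fin n → Bool) → (∀ i → f i ≡ true) → allFin n f ≡ true
allFin-true zero    f all = refl
allFin-true (suc n) f all rewrite all zero = allFin-true n (λ i → f (suc i)) (λ i → all (suc i))

allFin-false : ∀ n (f : Fin n → Bool) i → f i ≡ false → allFin n f ≡ false
allFin-false (suc n) f zero    fi rewrite fi = refl
allFin-false (suc n) f (suc i) fi with f zero
... | true  = allFin-false n (λ k → f (suc k)) i fi
... | false = refl

[,]′-splitAt-all : ∀ {A : Set} (P : A → Set) m {n} {f : Fin m → A} {g : Fin n → A} →
                   (∀ i → P (f i)) → (∀ j → P (g j)) → ∀ k → P ([ f , g ]′ (splitAt m k))
[,]′-splitAt-all P m Pf Pg k with splitAt m k
... | inj₁ i = Pf i
... | inj₂ j = Pg j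

leftWinsL-endLike : ∀ G → LeftEndLike G → leftWinsL G ≡ true
leftWinsL-endLike (mkA _ _ _ _ _ _) e = cong (_∨ _) e

leftWinsL-move : ∀ G i → leftWinsR (leftOpt G i) ≡ true → leftWinsL G ≡ true
leftWinsL-move G@(mkA _ _ nL _ gL _) i w =
  trans (cong (leftEndLike? G ∨_) (anyFin-true nL (λ k → leftWinsR (gL k)) i w)) (∨-zeroʳ _)

leftWinsL-false : ∀ G → leftEndLike? G ≡ false → (∀ i → leftWinsR (leftOpt G i) ≡ false) →
                  leftWinsL G ≡ false
leftWinsL-false (mkA _ _ nL _ _ _) e loses = cong₂ _∨_ e (anyFin-false nL _ loses)

leftWinsR-endLike : ∀ G → RightEndLike G → leftWinsR G ≡ false
leftWinsR-endLike (mkA _ _ _ _ _ _) e = cong (if_then false else _) e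

leftWinsR-move : ∀ G j → leftWinsL (rightOpt G j) ≡ false → leftWinsR G ≡ false
leftWinsR-move G@(mkA _ _ _ nR _ _) j w with rightEndLike? G
... | true  = refl
... | false = allFin-false nR _ j w

leftWinsR-true : ∀ G → rightEndLike? G ≡ false → (∀ j → leftWinsL (rightOpt G j) ≡ true) →
                 leftWinsR G ≡ true
leftWinsR-true (mkA _ _ _ nR _ _) e wins rewrite e = allFin-true nR _ wins

isZero-+ : ∀ m n → isZero (m + n) ≡ isZero m ∧ isZero n
isZero-+ zero    n = refl
isZero-+ (suc m) n = refl

-- a, c: the tombstones of the two summands; b, d: whether they have no options.
endLike-⊕-law : ∀ a b c d → ((a ∨ b) ∧ (c ∨ d)) ∧ (a ∨ c) ∨ (b ∧ d) ≡ (a ∨ b) ∧ (c ∨ d)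
endLike-⊕-law true  b     true  d     = refl
endLike-⊕-law true  b     false true  = refl
endLike-⊕-law true  true  false false = refl
endLike-⊕-law true  false false false = refl
endLike-⊕-law false true  true  d     = refl
endLike-⊕-law false false true  d     = refl
endLike-⊕-law false true  false true  = refl
endLike-⊕-law false true  false false = refl
endLike-⊕-law false false false d     = refl

leftEndLike?-⊕ : ∀ G H → leftEndLike? (G ⊕ H) ≡ leftEndLike? G ∧ leftEndLike? H
leftEndLike?-⊕ (mkA tL _ nL _ _ _) (mkA sL _ mL _ _ _)
  rewrite isZero-+ nL mL = endLike-⊕-law tL (isZero nL) sL (isZero mL)

rightEndLike?-⊕ : ∀ G H → rightEndLike? (G ⊕ H) ≡ rightEndLike? G ∧ rightEndLike? H
rightEndLike?-⊕ (mkA _ tR _ nR _ _) (mkA _ sR _ mR _ _)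
  rewrite isZero-+ nR mR = endLike-⊕-law tR (isZero nR) sR (isZero mR)

leftWinsL-⊕ˡ : ∀ G H i → leftWinsR (leftOpt G i ⊕ H) ≡ true → leftWinsL (G ⊕ H) ≡ true
leftWinsL-⊕ˡ G@(mkA _ _ nL _ _ _) H@(mkA _ _ mL _ _ _) i w =
  leftWinsL-move (G ⊕ H) (i ↑ˡ mL)
    (subst (λ s → leftWinsR ([ _ , _ ]′ s) ≡ true) (sym (splitAt-↑ˡ nL i mL)) w)

leftWinsL-⊕ʳ : ∀ G H j → leftWinsR (G ⊕ leftOpt H j) ≡ true → leftWinsL (G ⊕ H) ≡ true
leftWinsL-⊕ʳ G@(mkA _ _ nL _ _ _) H@(mkA _ _ mL _ _ _) j w =
  leftWinsL-move (G ⊕ H) (nL ↑ʳ j)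
    (subst (λ s → leftWinsR ([ _ , _ ]′ s) ≡ true) (sym (splitAt-↑ʳ nL mL j)) w)

leftWinsR-⊕ˡ : ∀ G H j → leftWinsL (rightOpt G j ⊕ H) ≡ false → leftWinsR (G ⊕ H) ≡ false
leftWinsR-⊕ˡ G@(mkA _ _ _ nR _ _) H@(mkA _ _ _ mR _ _) j w =
  leftWinsR-move (G ⊕ H) (j ↑ˡ mR)
    (subst (λ s → leftWinsL ([ _ , _ ]′ s) ≡ false) (sym (splitAt-↑ˡ nR j mR)) w)

leftWinsR-⊕ʳ : ∀ G H j → leftWinsL (G ⊕ rightOpt H j) ≡ false → leftWinsR (G ⊕ H) ≡ false
leftWinsR-⊕ʳ G@(mkA _ _ _ nR _ _) H@(mkA _ _ _ mR _ _) j w =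
  leftWinsR-move (G ⊕ H) (nR ↑ʳ j)
    (subst (λ s → leftWinsL ([ _ , _ ]′ s) ≡ false) (sym (splitAt-↑ʳ nR mR j)) w)

leftWinsL-⊕-false : ∀ G H → leftEndLike? (G ⊕ H) ≡ false →
                    (∀ i → leftWinsR (leftOpt G i ⊕ H) ≡ false) →
                    (∀ j → leftWinsR (G ⊕ leftOpt H j) ≡ false) →
                    leftWinsL (G ⊕ H) ≡ false
leftWinsL-⊕-false G@(mkA _ _ nL _ _ _) H@(mkA _ _ _ _ _ _) e losesG losesH =
  leftWinsL-false (G ⊕ H) e ([,]′-splitAt-all (λ K → leftWinsR K ≡ false) nL losesG losesH)

leftWinsR-⊕-true : ∀ G H → rightEndLike? (G ⊕ H) ≡ false →
                   (∀ j → leftWinsL (rightOpt G j ⊕ H) ≡ true) →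
                   (∀ j → leftWinsL (G ⊕ rightOpt H j) ≡ true) →
                   leftWinsR (G ⊕ H) ≡ true
leftWinsR-⊕-true G@(mkA _ _ _ nR _ _) H@(mkA _ _ _ _ _ _) e winsG winsH =
  leftWinsR-true (G ⊕ H) e ([,]′-splitAt-all (λ K → leftWinsL K ≡ true) nR winsG winsH)

leftSpoiler leftSpoilerMove : AForm → Game
leftSpoiler H@(mkA _ _ nL _ gL _) = mkG 1 nL (λ _ → leftSpoilerMove H) (λ i → leftSpoiler (gL i))
leftSpoilerMove (mkA _ _ _ zero    _ _)  = zeroG
leftSpoilerMove (mkA _ _ _ (suc _) _ gR) = leftSpoiler (gR zero)

rightSpoiler rightSpoilerMove : AForm → Game
rightSpoiler H@(mkA _ _ _ nR _ gR) = mkG nR 1 (λ j → rightSpoiler (gR j)) (λ _ → rightSpoilerMove H)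
rightSpoilerMove (mkA _ _ zero    _ _  _) = zeroG
rightSpoilerMove (mkA _ _ (suc _) _ gL _) = rightSpoiler (gL zero)

leftSpoiler-wins : ∀ H → leftWinsL (H ⊕ ι (leftSpoiler H)) ≡ false
leftSpoilerMove-wins : ∀ H → leftWinsR (H ⊕ ι (leftSpoilerMove H)) ≡ false

leftSpoiler-wins H@(mkA _ _ _ _ gL _) =
  leftWinsL-⊕-false H (ι (leftSpoiler H)) (trans (leftEndLike?-⊕ H (ι (leftSpoiler H))) (∧-zeroʳ _))
    (λ i → leftWinsR-⊕ʳ (gL i) (ι (leftSpoiler H)) i (leftSpoiler-wins (gL i)))
    (λ _ → leftSpoilerMove-wins H)

leftSpoilerMove-wins H@(mkA _ tR _ zero _ _) =
  leftWinsR-endLike (H ⊕ ι zeroG)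
    (trans (rightEndLike?-⊕ H (ι zeroG)) (trans (∧-identityʳ _) (∨-zeroʳ tR)))
leftSpoilerMove-wins H@(mkA _ _ _ (suc _) _ gR) =
  leftWinsR-⊕ˡ H (ι (leftSpoiler (gR zero))) zero (leftSpoiler-wins (gR zero))

rightSpoiler-wins : ∀ H → leftWinsR (H ⊕ ι (rightSpoiler H)) ≡ true
rightSpoilerMove-wins : ∀ H → leftWinsL (H ⊕ ι (rightSpoilerMove H)) ≡ true

rightSpoiler-wins H@(mkA _ _ _ _ _ gR) =
  leftWinsR-⊕-true H (ι (rightSpoiler H)) (trans (rightEndLike?-⊕ H (ι (rightSpoiler H))) (∧-zeroʳ _))
    (λ j → leftWinsL-⊕ʳ (gR j) (ι (rightSpoiler H)) j (rightSpoiler-wins (gR j)))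
    (λ _ → rightSpoilerMove-wins H)

rightSpoilerMove-wins H@(mkA tL _ zero _ _ _) =
  leftWinsL-endLike (H ⊕ ι zeroG)
    (trans (leftEndLike?-⊕ H (ι zeroG)) (trans (∧-identityʳ _) (∨-zeroʳ tL)))
rightSpoilerMove-wins H@(mkA _ _ (suc _) _ gL _) =
  leftWinsL-⊕ˡ H (ι (rightSpoiler (gL zero))) zero (rightSpoiler-wins (gL zero))

ι-leftEnd : ∀ X → IsLeftEnd X → LeftEndLike (ι X)
ι-leftEnd (mkG _ _ _ _) refl = refl

ι-rightEnd : ∀ X → IsRightEnd X → RightEndLike (ι X)
ι-rightEnd (mkG _ _ _ _) refl = refl

leftEndLike⇒leftStrong : ∀ 𝒜 G → LeftEndLike G → LeftStrong 𝒜 G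
leftEndLike⇒leftStrong 𝒜 G endLike X _ end =
  cong (if_then 𝓛 else 𝓡) (leftWinsL-endLike (G ⊕ ι X)
    (trans (leftEndLike?-⊕ G (ι X)) (cong₂ _∧_ endLike (ι-leftEnd X end))))

rightEndLike⇒rightStrong : ∀ 𝒜 G → RightEndLike G → RightStrong 𝒜 G
rightEndLike⇒rightStrong 𝒜 G endLike X _ end =
  cong (if_then 𝓛 else 𝓡) (leftWinsR-endLike (G ⊕ ι X)
    (trans (rightEndLike?-⊕ G (ι X)) (cong₂ _∧_ endLike (ι-rightEnd X end))))

leftStrong⇒leftEndLike : ∀ G → LeftStrong 𝓜 G → LeftEndLike G
leftStrong⇒leftEndLike G strong with leftEndLike? G in notEndLike
... | true  = refl
... | false = ⊥-elim (𝓡≢𝓛 (trans (sym (cong (if_then 𝓛 else 𝓡) leftLoses)) (strong X tt refl)))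
  where
  X : Game
  X = mkG 0 (nLeft G) (λ ()) (λ i → leftSpoiler (leftOpt G i))
  leftLoses : leftWinsL (G ⊕ ι X) ≡ false
  leftLoses = leftWinsL-⊕-false G (ι X) (trans (leftEndLike?-⊕ G (ι X)) (cong (_∧ _) notEndLike))
    (λ i → leftWinsR-⊕ʳ (leftOpt G i) (ι X) i (leftSpoiler-wins (leftOpt G i)))
    (λ ())

rightStrong⇒rightEndLike : ∀ G → RightStrong 𝓜 G → RightEndLike G
rightStrong⇒rightEndLike G strong with rightEndLike? G in notEndLike
... | true  = refl
... | false = ⊥-elim (𝓡≢𝓛 (trans (sym (strong X tt refl)) (cong (if_then 𝓛 else 𝓡) leftWins)))
  where
  X : Game
  X = mkG (nRight G) 0 (λ j → rightSpoiler (rightOpt G j)) (λ ())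
  leftWins : leftWinsR (G ⊕ ι X) ≡ true
  leftWins = leftWinsR-⊕-true G (ι X) (trans (rightEndLike?-⊕ G (ι X)) (cong (_∧ _) notEndLike))
    (λ j → leftWinsL-⊕ʳ (rightOpt G j) (ι X) j (rightSpoiler-wins (rightOpt G j)))
    (λ ())

proposition5p2 : Weak 𝓜
proposition5p2 =
  (λ G → mk⇔ (leftStrong⇒leftEndLike G) (leftEndLike⇒leftStrong 𝓜 G)) ,
  (λ G → mk⇔ (rightStrong⇒rightEndLike G) (rightEndLike⇒rightStrong 𝓜 G))
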